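{- For every finite poset $P$, \[X_{\mathrm{inc}(P)}=\omega(U_P).\]
   Context: For $I\subseteq[n-1]$, $F_I=\sum x_{i_1}\cdots x_{i_n}$ over $1\le i_1\le\cdots\le i_n$ with $i_j<i_{j+1}$ for $j\in I$ (fundamental quasisymmetric function). $\omega$ is the involutive automorphism of the algebra of quasisymmetric functions with $\omega(F_I)=F_{[n-1]\setminus I}$ (it restricts to the usual involution $\omega$ on symmetric functions). For a digraph $X=(V,E)$ with $|V|=n$ ($E\subseteq V\times V$) and a $V$-listing $\sigma=(\sigma_1,\ldots,\sigma_n)$ (all elements of $V$ listed once), $X\mathrm{Des}(\sigma)=\{i\in[n-1]\mid(\sigma_i,\sigma_{i+1})\in E\}$; the Redei-Berge function is $U_X=\sum_{\sigma}F_{X\mathrm{Des}(\sigma)}$ over all $V$-listings. For a poset $P$, $D_P$ is the digraph on $P$ with $(i,j)$ an edge iff $i<_Pj$, and $U_P=U_{D_P}$. $\mathrm{inc}(P)$ is the graph on $P$ whose edges are the pairs of incomparable elements, and for a graph $G$, $X_G=\sum_f\prod_v x_{f(v)}$ over proper colorings $f:V\to\mathbb{N}$ is Stanley's chromatic symmetric function. -}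

module Defs where

open import Data.Bool using (Bool; true; false; if_then_else_; _∧_; not)
open import Data.Nat using (ℕ; zero; suc; pred; _<ᵇ_; _≤ᵇ_; _≡ᵇ_)
open import Data.Fin using (Fin; toℕ)
open import Data.Fin.Subset using (Subset; ∁)
open import Data.List using (List; []; _∷_; allFin; concatMap; filter; length; map)
open import Data.Bool.ListAction using (and)
open import Data.Nat.ListAction using (sum)
open import Data.Vec using (Vec; []; _∷_; lookup; toList)
open import Relation.Binary.PropositionalEquality using (_≡_)
open import Relation.Binary.Structures using (IsDecStrictPartialOrder)
open import Relation.Nullary.Decidable using (⌊_⌋; does)
import Data.Fin as F

-- Finite posets: a finite poset is (up to isomorphism) a decidable strict
-- partial order on Fin n.

record FinPoset (n : ℕ) : Set₁ where
  field
    _<P_  : Fin n → Fin n → Set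
    isDSPO : IsDecStrictPartialOrder _≡_ _<P_
  open IsDecStrictPartialOrder isDSPO public using (_<?_)

allVecs : ∀ {A : Set} → List A → (k : ℕ) → List (Vec A k)
allVecs xs zero = [] ∷ []
allVecs xs (suc k) = concatMap (λ x → map (x ∷_) (allVecs xs k)) xs

count : ∀ {A : Set} → (A → Bool) → List A → ℕ
count p xs = length (filter (λ x → Data.Bool.T? (p x)) xs)
  where import Data.Bool

eqFin : ∀ {m} → Fin m → Fin m → Bool
eqFin i j = ⌊ i F.≟ j ⌋

occ : ∀ {m k} → Fin m → Vec (Fin m) k → ℕ
occ c v = count (eqFin c) (toList v)

-- the vector v has content α, i.e. the monomial ∏ x_{v_i} equals x^α
hasContent : ∀ {m k} → Vec ℕ m → Vec (Fin m) k → Bool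
hasContent {m} α v = and (map (λ c → occ c v ≡ᵇ lookup α c) (allFin m))

-- Formal power series in variables x_0, x_1, … are compared coefficientwise:
-- the coefficient of the monomial x_0^{α_0} ⋯ x_{m-1}^{α_{m-1}} for α : Vec ℕ m
-- (every monomial arises this way for m large enough).

-- Fundamental quasisymmetric function F_I of degree n, I ⊆ [n-1].
-- Gaps of a sequence of length n are indexed by Fin (pred n);
-- gap j is between positions j and j+1.

compatible : ∀ {m k} → Vec (Fin m) k → Subset (pred k) → Bool
compatible [] [] = true
compatible (x ∷ []) [] = true
compatible (x ∷ y ∷ xs) (b ∷ bs) =
  (if b then toℕ x <ᵇ toℕ y else toℕ x ≤ᵇ toℕ y) ∧ compatible (y ∷ xs) bs

coeffF : ∀ {n} → Subset (pred n) → (m : ℕ) → Vec ℕ m → ℕ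
coeffF {n} I m α =
  count (λ s → compatible s I ∧ hasContent α s) (allVecs (allFin m) n)

-- A quasisymmetric function of degree n given by its expansion
-- Σ_{I ∈ list} F_I in the fundamental basis (with multiplicities).
record FExp (n : ℕ) : Set where
  constructor fexp
  field terms : List (Subset (pred n))

coeffFExp : ∀ {n} → FExp n → (m : ℕ) → Vec ℕ m → ℕ
coeffFExp {n} (fexp E) m α = sum (map (λ I → coeffF {n} I m α) E)

-- ω(F_I) = F_{[n-1] ∖ I}, extended linearly
ωF : ∀ {n} → FExp n → FExp n
ωF (fexp E) = fexp (map ∁ E)

-- digraph on Fin n given by a decidable edge relation
XDes : ∀ {n k} → (Fin n → Fin n → Bool) → Vec (Fin n) k → Subset (pred k)
XDes E [] = []
XDes E (x ∷ []) = []
XDes E (x ∷ y ∷ xs) = E x y ∷ XDes E (y ∷ xs)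

isListing : ∀ {n} → Vec (Fin n) n → Bool
isListing {n} σ = and (map (λ c → occ c σ ≡ᵇ 1) (allFin n))

listings : (n : ℕ) → List (Vec (Fin n) n)
listings n = filter (λ σ → Data.Bool.T? (isListing σ)) (allVecs (allFin n) n)
  where import Data.Bool

U-digraph : ∀ {n} → (Fin n → Fin n → Bool) → FExp n
U-digraph {n} E = fexp (map (XDes E) (listings n))

D : ∀ {n} → FinPoset n → Fin n → Fin n → Bool
D P i j = does (i <? j)
  where open FinPoset P

U : ∀ {n} → FinPoset n → FExp n
U P = U-digraph (D P)

incEdge : ∀ {n} → FinPoset n → Fin n → Fin n → Bool
incEdge P u v = not (eqFin u v) ∧ not (D P u v) ∧ not (D P v u)

isProper : ∀ {n m} → (Fin n → Fin n → Bool) → Vec (Fin m) n → Bool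
isProper {n} G f =
  and (map (λ u → and (map (λ v →
        if G u v then not (eqFin (lookup f u) (lookup f v)) else true)
      (allFin n))) (allFin n))

-- coefficient of x^α in X_G
coeffX : ∀ {n} → (Fin n → Fin n → Bool) → (m : ℕ) → Vec ℕ m → ℕ
coeffX {n} G m α =
  count (λ f → isProper G f ∧ hasContent α f) (allVecs (allFin m) n)

-- Expanding ω(U_P) = Σ_σ F_{[n-1] ∖ XDes(σ)} into monomials, a monomial of the term of σ is
-- x_{f(σ₁)} ⋯ x_{f(σₙ)} for a colouring f : P → ℕ, and the compatibility condition says
-- exactly that σ increases for the order u ≺ v :⇔ f u < f v, or f u = f v and u <_P v.
-- Exchanging the sums over σ and f, the coefficient of x^α counts the colourings of content α,
-- each weighted by the number of ≺-increasing listings. When every colour class is a chain of P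
-- (f is a proper colouring of inc(P)), ≺ is a total order and there is exactly one such listing,
-- P sorted by ≺; otherwise two incomparable elements of one colour can never be ordered, and
-- there is none. What remains is the coefficient of x^α in X_inc(P).
module Submission where

open import Defs
open import Data.Bool using (Bool; true; false; T; T?; if_then_else_; _∧_; not)
open import Data.Bool.ListAction using (and; all)
open import Data.Bool.Properties using (∧-identityʳ; ∧-zeroʳ)
open import Data.Empty using (⊥-elim)
open import Data.Fin as Fin using (Fin; toℕ)
open import Data.Fin.Properties using (toℕ-injective)
open import Data.Fin.Subset using (∁)
open import Data.List as List using (List; []; _∷_; _++_; map; length; concatMap; cartesianProductWith)
open import Data.List.Membership.Propositional using (_∈_)
open import Data.List.Membership.Propositional.Properties
  using (∈-allFin; ∈-map⁺; ∈-filter⁺; ∈-filter⁻; ∈-cartesianProductWith⁺)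
open import Data.List.Membership.Propositional.Properties.WithK using (unique∧set⇒bag)
open import Data.List.Properties
  using (map-∘; map-cong; map-cong-local; map-tabulate; length-tabulate;
         filter-accept; filter-reject; filter-none; filter-some)
open import Data.List.Relation.Binary.BagAndSetEquality using (∼bag⇒↭)
open import Data.List.Relation.Binary.Permutation.Propositional
  using (_↭_; ↭-sym; ↭⇒↭ₛ; module PermutationReasoning)
open import Data.List.Relation.Binary.Permutation.Propositional.Properties
  using (↭-length; filter-↭; ∈-resp-↭) renaming (map⁺ to ↭-map⁺)
import Data.List.Relation.Binary.Permutation.Setoid.Properties as PermutationSetoidProperties
open import Data.List.Relation.Binary.Pointwise using (Pointwise-≡⇒≡)
open import Data.List.Relation.Unary.All as All using ([]; _∷_)
open import Data.List.Relation.Unary.All.Properties using (all⁺; all⁻)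
open import Data.List.Relation.Unary.AllPairs as AllPairs using (AllPairs; []; _∷_)
open import Data.List.Relation.Unary.Any as Any using (Any; here; there)
open import Data.List.Relation.Unary.Linked as Linked using (Linked; linked?)
open import Data.List.Relation.Unary.Linked.Properties using (Linked⇒AllPairs; AllPairs⇒Linked)
open import Data.List.Relation.Unary.Sorted.TotalOrder.Properties using (Sorted⇒AllPairs; ↗↭↗⇒≋)
open import Data.List.Relation.Unary.Unique.Propositional using (Unique)
import Data.List.Relation.Unary.Unique.Propositional.Properties as Unique
open import Data.Nat as Nat using (ℕ; zero; suc; _+_; _≤_; _<_; s≤s; _<ᵇ_; _≤ᵇ_; _≡ᵇ_)
open import Data.Nat.ListAction using (sum)
open import Data.Nat.Properties
  using (≤-refl; ≤-reflexive; ≤-trans; <-irrefl; <-trans; <⇒≤; n≤1+n; 1+n≢0; <-cmp;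
         m≤n⇒m<n∨m≡n; ≡ᵇ⇒≡; ≡⇒≡ᵇ; +-commutativeSemigroup)
open import Algebra.Properties.CommutativeSemigroup +-commutativeSemigroup using (interchange)
open import Data.Product using (_×_; _,_; proj₂)
open import Data.Sum as Sum using (_⊎_; inj₁; inj₂; [_,_]′)
open import Data.Vec as Vec using (Vec; lookup; toList)
open import Data.Vec.Membership.Propositional.Properties using (∈-toList⁺; ∈-toList⁻; ∈-lookup)
open import Data.Vec.Properties
  using (∷-injective; lookup-map; lookup∘tabulate; tabulate∘lookup; tabulate-cong; toList-map;
         toList-cast; toList∘fromList; toList-injective; cast-is-id)
import Data.Vec.Relation.Unary.Any as VecAny
open import Data.Vec.Relation.Unary.Any.Properties using (lookup-index)
open import Function using (id; _∘_; flip; _⇔_; mk⇔; Equivalence; _↔_; mk↔ₛ′; Inverse; Injection)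
open import Function.Properties.Inverse using (↔⇒↣)
open import Relation.Binary.Bundles using (StrictTotalOrder)
open import Relation.Binary.Definitions
  using (DecidableEquality; Decidable; Irreflexive; Transitive; Trichotomous; tri<; tri≈; tri>)
import Relation.Binary.Properties.StrictTotalOrder as StrictTotalOrderProperties
open import Relation.Binary.PropositionalEquality
  using (_≡_; _≢_; refl; sym; trans; cong; cong₂; subst; module ≡-Reasoning)
import Relation.Binary.PropositionalEquality as ≡
open import Relation.Binary.Structures using (IsStrictPartialOrder; IsDecStrictPartialOrder)
open import Relation.Nullary using (¬_; Dec; yes; no; does)
open import Relation.Nullary.Decidable using (⌊_⌋; fromWitness; toWitness; map′)

open Equivalence using (to; from)

T-does⇔ : {A : Set} (a? : Dec A) → T (does a?) ⇔ A
T-does⇔ (yes a) = mk⇔ (λ _ → a) _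
T-does⇔ (no ¬a) = mk⇔ ⊥-elim ¬a

T-all-allFin⇔ : {n : ℕ} (p : Fin n → Bool) → T (all p (List.allFin n)) ⇔ (∀ i → T (p i))
T-all-allFin⇔ {n} p = mk⇔
  (λ t i → All.lookup (all⁺ p (List.allFin n) t) (∈-allFin i))
  (λ pᵢ → all⁻ p {xs = List.allFin n} (All.tabulate λ {i} _ → pᵢ i))

indicator : Bool → ℕ
indicator b = if b then 1 else 0

module _ {A : Set} where

  count-↭ : (p : A → Bool) {xs ys : List A} → xs ↭ ys → count p xs ≡ count p ys
  count-↭ p xs↭ys = ↭-length (filter-↭ _ xs↭ys)

  count-cong : {p q : A → Bool} {xs : List A} → (∀ {x} → x ∈ xs → p x ≡ q x) → count p xs ≡ count q xs
  count-cong {xs = []} p≡q = refl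
  count-cong {p} {q} {x ∷ xs} p≡q rewrite p≡q (here refl) with q x
  ... | true  = cong suc (count-cong (p≡q ∘ there))
  ... | false = count-cong (p≡q ∘ there)

  count-none : {p : A → Bool} {xs : List A} → (∀ {x} → x ∈ xs → ¬ T (p x)) → count p xs ≡ 0
  count-none ¬p = cong length (filter-none _ (All.tabulate ¬p))

  count-unique : {p : A → Bool} {xs : List A} {x : A} → Unique xs → x ∈ xs → T (p x) →
                 (∀ {y} → y ∈ xs → T (p y) → y ≡ x) → count p xs ≡ 1
  count-unique {p} (x∉xs ∷ _) (here refl) px only =
    trans (cong length (filter-accept (T? ∘ p) px))
          (cong suc (count-none λ y∈xs py → All.lookup x∉xs y∈xs (sym (only (there y∈xs) py))))
  count-unique {p} {y ∷ _} (y∉xs ∷ u) (there x∈xs) px only =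
    trans (cong length (filter-reject (T? ∘ p) ¬py)) (count-unique u x∈xs px (only ∘ there))
    where
    ¬py : ¬ T (p y)
    ¬py py = All.lookup y∉xs x∈xs (only (here refl) py)

  count-∷-mono : (p : A → Bool) (x : A) (xs : List A) → count p xs ≤ count p (x ∷ xs)
  count-∷-mono p x xs with p x
  ... | true  = n≤1+n _
  ... | false = ≤-refl

  count-≢0⇒any : (p : A → Bool) (xs : List A) → count p xs ≢ 0 → Any (T ∘ p) xs
  count-≢0⇒any p [] c≢0 = ⊥-elim (c≢0 refl)
  count-≢0⇒any p (x ∷ xs) c≢0 with p x in px
  ... | true  = here (subst T (sym px) _)
  ... | false = there (count-≢0⇒any p xs c≢0)

  count-as-sum : (p : A → Bool) (xs : List A) → count p xs ≡ sum (map (indicator ∘ p) xs)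
  count-as-sum p [] = refl
  count-as-sum p (x ∷ xs) with p x
  ... | true  = cong suc (count-as-sum p xs)
  ... | false = count-as-sum p xs

count-map : {A B : Set} (p : B → Bool) (g : A → B) (xs : List A) → count p (map g xs) ≡ count (p ∘ g) xs
count-map p g [] = refl
count-map p g (x ∷ xs) with p (g x)
... | true  = cong suc (count-map p g xs)
... | false = count-map p g xs

sum-map-+ : {A : Set} (g h : A → ℕ) (xs : List A) →
            sum (map (λ x → g x + h x) xs) ≡ sum (map g xs) + sum (map h xs)
sum-map-+ g h [] = refl
sum-map-+ g h (x ∷ xs) = trans (cong (g x + h x +_) (sum-map-+ g h xs)) (interchange (g x) (h x) _ _)

sum-map-0 : {A : Set} (xs : List A) → sum (map (λ _ → 0) xs) ≡ 0
sum-map-0 [] = refl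
sum-map-0 (x ∷ xs) = sum-map-0 xs

sum-comm : {A B : Set} (g : A → B → ℕ) (xs : List A) (ys : List B) →
           sum (map (λ x → sum (map (g x) ys)) xs) ≡ sum (map (λ y → sum (map (λ x → g x y) xs)) ys)
sum-comm g [] ys = sym (sum-map-0 ys)
sum-comm g (x ∷ xs) ys =
  trans (cong (sum (map (g x) ys) +_) (sum-comm g xs ys)) (sym (sum-map-+ (g x) _ ys))

sum-count-comm : {A B : Set} (r : A → B → Bool) (xs : List A) (ys : List B) →
                 sum (map (λ x → count (r x) ys) xs) ≡ sum (map (λ y → count (λ x → r x y) xs) ys)
sum-count-comm r xs ys = begin
  sum (map (λ x → count (r x) ys) xs)
    ≡⟨ cong sum (map-cong (λ x → count-as-sum (r x) ys) xs) ⟩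
  sum (map (λ x → sum (map (λ y → indicator (r x y)) ys)) xs)
    ≡⟨ sum-comm (λ x y → indicator (r x y)) xs ys ⟩
  sum (map (λ y → sum (map (λ x → indicator (r x y)) xs)) ys)
    ≡⟨ cong sum (map-cong (λ y → count-as-sum (λ x → r x y) xs) ys) ⟨
  sum (map (λ y → count (λ x → r x y) xs) ys) ∎
  where open ≡-Reasoning

AllPairs-related : {A : Set} {R : A → A → Set} {xs : List A} → AllPairs R xs →
                   ∀ {x y} → x ∈ xs → y ∈ xs → x ≢ y → R x y ⊎ R y x
AllPairs-related (_ ∷ _)     (here refl) (here refl) x≢y = ⊥-elim (x≢y refl)
AllPairs-related (Rx ∷ _)    (here refl) (there y∈)  _   = inj₁ (All.lookup Rx y∈)
AllPairs-related (Rx ∷ _)    (there x∈)  (here refl) _   = inj₂ (All.lookup Rx x∈)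
AllPairs-related (_ ∷ pairs) (there x∈)  (there y∈)  x≢y = AllPairs-related pairs x∈ y∈ x≢y

record IsEnumeration {A : Set} (xs : List A) : Set where
  field
    unique   : Unique xs
    complete : ∀ x → x ∈ xs

module _ {A : Set} where
  open IsEnumeration

  enumeration-↭ : {xs ys : List A} → IsEnumeration xs → IsEnumeration ys → xs ↭ ys
  enumeration-↭ exs eys = ∼bag⇒↭ (unique∧set⇒bag (unique exs) (unique eys)
                                    (mk⇔ (λ _ → complete eys _) (λ _ → complete exs _)))

  enumeration-resp-↭ : {xs ys : List A} → xs ↭ ys → IsEnumeration xs → IsEnumeration ys
  enumeration-resp-↭ xs↭ys exs = record
    { unique   = PermutationSetoidProperties.Unique-resp-↭ (≡.setoid A) (↭⇒↭ₛ xs↭ys) (unique exs)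
    ; complete = λ x → ∈-resp-↭ xs↭ys (complete exs x)
    }

  count-enumeration-↔ : (p : A → Bool) {xs : List A} → IsEnumeration xs → (φ : A ↔ A) →
                        count p xs ≡ count (p ∘ Inverse.to φ) xs
  count-enumeration-↔ p {xs} exs φ = trans (count-↭ p (enumeration-↭ exs image)) (count-map p φ.to xs)
    where
    module φ = Inverse φ
    image : IsEnumeration (map φ.to xs)
    image = record
      { unique   = Unique.map⁺ (Injection.injective (↔⇒↣ φ)) (unique exs)
      ; complete = λ y → subst (_∈ map φ.to xs) (φ.strictlyInverseˡ y) (∈-map⁺ φ.to (complete exs (φ.from y)))
      }

  module _ (_≟_ : DecidableEquality A) where

    multiplicity : A → List A → ℕ
    multiplicity c = count (λ x → ⌊ c ≟ x ⌋)

    multiplicity-∈ : {c : A} {xs : List A} → c ∈ xs → 0 < multiplicity c xs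
    multiplicity-∈ c∈xs = filter-some _ (Any.map fromWitness c∈xs)

    multiplicity≤1⇒unique : {xs : List A} → (∀ c → multiplicity c xs ≤ 1) → Unique xs
    multiplicity≤1⇒unique {[]} _ = []
    multiplicity≤1⇒unique {x ∷ xs} atMostOnce =
      All.tabulate x∉xs ∷ multiplicity≤1⇒unique (λ c → ≤-trans (count-∷-mono _ x xs) (atMostOnce c))
      where
      x∉xs : ∀ {y} → y ∈ xs → x ≢ y
      x∉xs x∈xs refl = <-irrefl refl (≤-trans (s≤s (multiplicity-∈ x∈xs)) (subst (_≤ 1) head (atMostOnce x)))
        where
        head : multiplicity x (x ∷ xs) ≡ suc (multiplicity x xs)
        head = cong length (filter-accept (λ y → T? ⌊ x ≟ y ⌋) (fromWitness {a? = x ≟ x} refl))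

    exactlyOnce⇔enumeration : {xs : List A} → (∀ c → multiplicity c xs ≡ 1) ⇔ IsEnumeration xs
    exactlyOnce⇔enumeration {xs} = mk⇔
      (λ once → record
        { unique   = multiplicity≤1⇒unique (λ c → ≤-reflexive (once c))
        ; complete = λ c → Any.map toWitness (count-≢0⇒any _ xs (1+n≢0 ∘ trans (sym (once c))))
        })
      (λ exs c → count-unique (unique exs) (complete exs c) (fromWitness refl) (λ _ → sym ∘ toWitness))

allFin-enumeration : (n : ℕ) → IsEnumeration (List.allFin n)
allFin-enumeration n = record { unique = Unique.allFin⁺ n ; complete = ∈-allFin }

concatMap-map≡cartesianProductWith : {A B C : Set} (f : A → B → C) (xs : List A) (ys : List B) →
  concatMap (λ x → map (f x) ys) xs ≡ cartesianProductWith f xs ys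
concatMap-map≡cartesianProductWith f [] ys = refl
concatMap-map≡cartesianProductWith f (x ∷ xs) ys =
  cong (map (f x) ys ++_) (concatMap-map≡cartesianProductWith f xs ys)

allVecs-enumeration : {A : Set} {xs : List A} → IsEnumeration xs → (k : ℕ) → IsEnumeration (allVecs xs k)
allVecs-enumeration exs zero = record { unique = [] ∷ [] ; complete = λ { Vec.[] → here refl } }
allVecs-enumeration {xs = xs} exs (suc k) =
  subst IsEnumeration (sym (concatMap-map≡cartesianProductWith Vec._∷_ xs (allVecs xs k))) record
    { unique   = Unique.cartesianProductWith⁺ Vec._∷_ ∷-injective (unique exs) (unique exsᵏ)
    ; complete = λ { (x Vec.∷ v) → ∈-cartesianProductWith⁺ Vec._∷_ (complete exs x) (complete exsᵏ v) }
    }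
  where
  open IsEnumeration
  exsᵏ = allVecs-enumeration exs k

module _ {n : ℕ} where

  listing⇔enumeration : {σ : Vec (Fin n) n} → σ ∈ listings n ⇔ IsEnumeration (toList σ)
  listing⇔enumeration {σ} = mk⇔
    (λ σ∈ → to exactlyOnce (isListing⇒once (proj₂ (∈-filter⁻ listing? {xs = allVecs (List.allFin n) n} σ∈))))
    (λ eσ → ∈-filter⁺ listing? (IsEnumeration.complete vectors σ) (once⇒isListing (from exactlyOnce eσ)))
    where
    listing? = T? ∘ isListing
    exactlyOnce = exactlyOnce⇔enumeration Fin._≟_
    vectors = allVecs-enumeration (allFin-enumeration n) n
    isListing⇒once : T (isListing σ) → ∀ c → multiplicity Fin._≟_ c (toList σ) ≡ 1
    isListing⇒once listing c = ≡ᵇ⇒≡ _ 1 (to (T-all-allFin⇔ _) listing c)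
    once⇒isListing : (∀ c → multiplicity Fin._≟_ c (toList σ) ≡ 1) → T (isListing σ)
    once⇒isListing once = from (T-all-allFin⇔ _) λ c → ≡⇒≡ᵇ _ 1 (once c)

  listings-unique : Unique (listings n)
  listings-unique = Unique.filter⁺ _ (IsEnumeration.unique (allVecs-enumeration (allFin-enumeration n) n))

lookup-extensionality : {A : Set} {k : ℕ} {xs ys : Vec A k} → (∀ i → lookup xs i ≡ lookup ys i) → xs ≡ ys
lookup-extensionality {xs = xs} {ys} eq =
  trans (sym (tabulate∘lookup xs)) (trans (tabulate-cong eq) (tabulate∘lookup ys))

toList≡tabulate-lookup : {A : Set} {k : ℕ} (xs : Vec A k) → toList xs ≡ List.tabulate (lookup xs)
toList≡tabulate-lookup Vec.[]       = refl
toList≡tabulate-lookup (x Vec.∷ xs) = cong (x ∷_) (toList≡tabulate-lookup xs)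

lookup-injective : {A : Set} {k : ℕ} (xs : Vec A k) → Unique (toList xs) →
                   ∀ {i j} → lookup xs i ≡ lookup xs j → i ≡ j
lookup-injective (x Vec.∷ xs) _ {Fin.zero} {Fin.zero} _ = refl
lookup-injective (x Vec.∷ xs) (x∉xs ∷ _) {Fin.zero} {Fin.suc j} x≡xsⱼ =
  ⊥-elim (All.lookup x∉xs (∈-toList⁺ (∈-lookup j xs)) x≡xsⱼ)
lookup-injective (x Vec.∷ xs) (x∉xs ∷ _) {Fin.suc i} {Fin.zero} xsᵢ≡x =
  ⊥-elim (All.lookup x∉xs (∈-toList⁺ (∈-lookup i xs)) (sym xsᵢ≡x))
lookup-injective (x Vec.∷ xs) (_ ∷ u) {Fin.suc i} {Fin.suc j} eq = cong Fin.suc (lookup-injective xs u eq)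

module Precompose {n : ℕ} (σ : Vec (Fin n) n) (eσ : IsEnumeration (toList σ)) where
  open IsEnumeration eσ

  position : Fin n → Fin n
  position v = VecAny.index (∈-toList⁻ (complete v))

  lookup-position : ∀ v → lookup σ (position v) ≡ v
  lookup-position v = sym (lookup-index (∈-toList⁻ (complete v)))

  position-lookup : ∀ i → position (lookup σ i) ≡ i
  position-lookup i = lookup-injective σ unique (lookup-position (lookup σ i))

  precompose : {C : Set} → Vec C n → Vec C n
  precompose f = Vec.map (lookup f) σ

  precompose-↔ : {C : Set} → Vec C n ↔ Vec C n
  precompose-↔ = mk↔ₛ′ precompose unprecompose precompose∘unprecompose unprecompose∘precompose
    where
    open ≡-Reasoning
    unprecompose : {C : Set} → Vec C n → Vec C n
    unprecompose s = Vec.tabulate (lookup s ∘ position)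
    precompose∘unprecompose : ∀ s → precompose (unprecompose s) ≡ s
    precompose∘unprecompose s = lookup-extensionality λ i → begin
      lookup (precompose (unprecompose s)) i  ≡⟨ lookup-map i _ σ ⟩
      lookup (unprecompose s) (lookup σ i)    ≡⟨ lookup∘tabulate _ (lookup σ i) ⟩
      lookup s (position (lookup σ i))        ≡⟨ cong (lookup s) (position-lookup i) ⟩
      lookup s i                              ∎
    unprecompose∘precompose : ∀ f → unprecompose (precompose f) ≡ f
    unprecompose∘precompose f = lookup-extensionality λ v → begin
      lookup (unprecompose (precompose f)) v  ≡⟨ lookup∘tabulate _ v ⟩
      lookup (precompose f) (position v)      ≡⟨ lookup-map (position v) _ σ ⟩
      lookup f (lookup σ (position v))        ≡⟨ cong (lookup f) (lookup-position v) ⟩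
      lookup f v                              ∎

  toList-precompose-↭ : {C : Set} (f : Vec C n) → toList (precompose f) ↭ toList f
  toList-precompose-↭ f = begin
    toList (precompose f)           ≡⟨ toList-map (lookup f) σ ⟩
    map (lookup f) (toList σ)       ↭⟨ ↭-map⁺ (lookup f) (enumeration-↭ eσ (allFin-enumeration n)) ⟩
    map (lookup f) (List.allFin n)  ≡⟨ map-tabulate id (lookup f) ⟩
    List.tabulate (lookup f)        ≡⟨ toList≡tabulate-lookup f ⟨
    toList f                        ∎
    where open PermutationReasoning

  hasContent-precompose : {m : ℕ} (α : Vec ℕ m) (f : Vec (Fin m) n) →
                          hasContent α (precompose f) ≡ hasContent α f
  hasContent-precompose {m} α f = cong and (map-cong occ-precompose (List.allFin m))
    where
    occ-precompose : ∀ c → (occ c (precompose f) ≡ᵇ lookup α c) ≡ (occ c f ≡ᵇ lookup α c)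
    occ-precompose c = cong (_≡ᵇ lookup α c) (count-↭ _ (toList-precompose-↭ f))

colourings : (n m : ℕ) → List (Vec (Fin m) n)
colourings n m = allVecs (List.allFin m) n

module ColourOrder {n : ℕ} (P : FinPoset n) {m : ℕ} (f : Vec (Fin m) n) where
  open FinPoset P
  open IsDecStrictPartialOrder isDSPO using () renaming (irrefl to <P-irrefl; trans to <P-trans)

  colour : Fin n → ℕ
  colour u = toℕ (lookup f u)

  _≺_ : Fin n → Fin n → Set
  u ≺ v = colour u < colour v ⊎ (colour u ≡ colour v × u <P v)

  ≺-irrefl : Irreflexive _≡_ _≺_
  ≺-irrefl refl (inj₁ lt)      = <-irrefl refl lt
  ≺-irrefl refl (inj₂ (_ , p)) = <P-irrefl refl p

  ≺-trans : Transitive _≺_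
  ≺-trans (inj₁ lt)       (inj₁ lt′)       = inj₁ (<-trans lt lt′)
  ≺-trans (inj₁ lt)       (inj₂ (eq′ , _)) = inj₁ (subst (_ <_) eq′ lt)
  ≺-trans (inj₂ (eq , _)) (inj₁ lt′)       = inj₁ (subst (_< _) (sym eq) lt′)
  ≺-trans (inj₂ (eq , p)) (inj₂ (eq′ , q)) = inj₂ (trans eq eq′ , <P-trans p q)

  ≺-isStrictPartialOrder : IsStrictPartialOrder _≡_ _≺_
  ≺-isStrictPartialOrder = record
    { isEquivalence = ≡.isEquivalence ; irrefl = ≺-irrefl ; trans = ≺-trans ; <-resp-≈ = ≡.resp₂ _≺_ }

  ≺-dec : ∀ {u v} → Dec (u <P v) → Dec (u ≺ v)
  ≺-dec {u} {v} (yes u<v) = map′ ≤⇒≺ ≺⇒≤ (colour u Nat.≤? colour v)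
    where
    ≤⇒≺ : colour u ≤ colour v → u ≺ v
    ≤⇒≺ le = Sum.map₂ (_, u<v) (m≤n⇒m<n∨m≡n le)
    ≺⇒≤ : u ≺ v → colour u ≤ colour v
    ≺⇒≤ (inj₁ lt)       = <⇒≤ lt
    ≺⇒≤ (inj₂ (eq , _)) = ≤-reflexive eq
  ≺-dec {u} {v} (no u≮v) = map′ inj₁ ≺⇒< (colour u Nat.<? colour v)
    where
    ≺⇒< : u ≺ v → colour u < colour v
    ≺⇒< (inj₁ lt)      = lt
    ≺⇒< (inj₂ (_ , p)) = ⊥-elim (u≮v p)

  -- Decided by cases on u <? v, so that does (u ≺? v) is the very Boolean that compatible tests.
  _≺?_ : Decidable _≺_
  u ≺? v = ≺-dec (u <? v)

  ascends : {k : ℕ} → Vec (Fin n) k → Bool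
  ascends σ = does (linked? _≺?_ (toList σ))

  ascends⇔ : {k : ℕ} (σ : Vec (Fin n) k) → T (ascends σ) ⇔ Linked _≺_ (toList σ)
  ascends⇔ σ = T-does⇔ (linked? _≺?_ (toList σ))

  compatible-∁XDes : {k : ℕ} (σ : Vec (Fin n) k) →
                     compatible (Vec.map (lookup f) σ) (∁ (XDes (D P) σ)) ≡ ascends σ
  compatible-∁XDes Vec.[]              = refl
  compatible-∁XDes (x Vec.∷ Vec.[])    = refl
  compatible-∁XDes (x Vec.∷ y Vec.∷ σ) = cong₂ _∧_ gap (compatible-∁XDes (y Vec.∷ σ))
    where
    gap : (if not (D P x y) then colour x <ᵇ colour y else colour x ≤ᵇ colour y) ≡ does (x ≺? y)
    gap with x <? y
    ... | yes _ = refl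
    ... | no _  = refl

  IsChainColouring : Set
  IsChainColouring = ∀ {u v} → u ≢ v → lookup f u ≡ lookup f v → u <P v ⊎ v <P u

  isProper⇔chainColouring : T (isProper (incEdge P) f) ⇔ IsChainColouring
  isProper⇔chainColouring = mk⇔
    (λ proper {u} {v} → to (properAt⇔ u v) (to (T-all-allFin⇔ _) (to (T-all-allFin⇔ _) proper u) v))
    (λ chain → from (T-all-allFin⇔ _) λ u → from (T-all-allFin⇔ _) λ v → from (properAt⇔ u v) chain)
    where
    properAt⇔ : ∀ u v → T (if incEdge P u v then not (eqFin (lookup f u) (lookup f v)) else true)
                        ⇔ (u ≢ v → lookup f u ≡ lookup f v → u <P v ⊎ v <P u)
    properAt⇔ u v with u Fin.≟ v | u <? v | v <? u
    ... | yes u≡v | _       | _       = mk⇔ (λ _ u≢v → ⊥-elim (u≢v u≡v)) _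
    ... | no _    | yes u<v | _       = mk⇔ (λ _ _ _ → inj₁ u<v) _
    ... | no _    | no _    | yes v<u = mk⇔ (λ _ _ _ → inj₂ v<u) _
    ... | no u≢v  | no u≮v  | no v≮u with lookup f u Fin.≟ lookup f v
    ...   | yes fu≡fv = mk⇔ ⊥-elim λ chain → [ u≮v , v≮u ]′ (chain u≢v fu≡fv)
    ...   | no fu≢fv  = mk⇔ (λ _ _ fu≡fv → ⊥-elim (fu≢fv fu≡fv)) _

  sameColour-≺⇒<P : ∀ {u v} → lookup f u ≡ lookup f v → u ≺ v → u <P v
  sameColour-≺⇒<P fu≡fv (inj₁ lt)      = ⊥-elim (<-irrefl (cong toℕ fu≡fv) lt)
  sameColour-≺⇒<P fu≡fv (inj₂ (_ , p)) = p

  ascending-enumeration⇒chainColouring : {xs : List (Fin n)} → Linked _≺_ xs → (∀ x → x ∈ xs) →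
                                         IsChainColouring
  ascending-enumeration⇒chainColouring ascending complete u≢v fu≡fv =
    Sum.map (sameColour-≺⇒<P fu≡fv) (sameColour-≺⇒<P (sym fu≡fv))
      (AllPairs-related (Linked⇒AllPairs ≺-trans ascending) (complete _) (complete _) u≢v)

  module ChainColouring (chain : IsChainColouring) where

    ≺-connected : ∀ {u v} → u ≢ v → u ≺ v ⊎ v ≺ u
    ≺-connected {u} {v} u≢v with <-cmp (colour u) (colour v)
    ... | tri< lt _ _ = inj₁ (inj₁ lt)
    ... | tri> _ _ gt = inj₂ (inj₁ gt)
    ... | tri≈ _ eq _ = Sum.map (λ u<v → inj₂ (eq , u<v)) (λ v<u → inj₂ (sym eq , v<u))
                                (chain u≢v (toℕ-injective eq))

    ≺-compare : Trichotomous _≡_ _≺_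
    ≺-compare u v with u Fin.≟ v
    ... | yes refl = tri≈ (≺-irrefl refl) refl (≺-irrefl refl)
    ... | no u≢v with ≺-connected u≢v
    ...   | inj₁ u≺v = tri< u≺v u≢v (≺-irrefl refl ∘ ≺-trans u≺v)
    ...   | inj₂ v≺u = tri> (≺-irrefl refl ∘ flip ≺-trans v≺u) u≢v v≺u

    ≺-strictTotalOrder : StrictTotalOrder _ _ _
    ≺-strictTotalOrder = record
      { isStrictTotalOrder = record { isStrictPartialOrder = ≺-isStrictPartialOrder ; compare = ≺-compare } }

    open StrictTotalOrderProperties ≺-strictTotalOrder using (decTotalOrder; totalOrder)
    open import Data.List.Sort decTotalOrder using (sort; sort-↭; sort-↗)

    sorted : List (Fin n)
    sorted = sort (List.allFin n)

    sorted-enumeration : IsEnumeration sorted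
    sorted-enumeration = enumeration-resp-↭ (↭-sym (sort-↭ (List.allFin n))) (allFin-enumeration n)

    sorted-ascending : Linked _≺_ sorted
    sorted-ascending = AllPairs⇒Linked (AllPairs.zipWith strict
      (Sorted⇒AllPairs totalOrder (sort-↗ (List.allFin n)) , IsEnumeration.unique sorted-enumeration))
      where
      strict : ∀ {u v} → (u ≺ v ⊎ u ≡ v) × u ≢ v → u ≺ v
      strict (inj₁ u≺v , _)   = u≺v
      strict (inj₂ u≡v , u≢v) = ⊥-elim (u≢v u≡v)

    length-sorted : length sorted ≡ n
    length-sorted = trans (↭-length (sort-↭ (List.allFin n))) (length-tabulate id)

    sortedListing : Vec (Fin n) n
    sortedListing = Vec.cast length-sorted (Vec.fromList sorted)

    toList-sortedListing : toList sortedListing ≡ sorted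
    toList-sortedListing = trans (toList-cast length-sorted (Vec.fromList sorted)) (toList∘fromList sorted)

    ascending-listing-unique : {σ : Vec (Fin n) n} → σ ∈ listings n → Linked _≺_ (toList σ) →
                               σ ≡ sortedListing
    ascending-listing-unique {σ} σ∈ ascending =
      trans (sym (cast-is-id refl σ)) (toList-injective refl σ sortedListing (begin
        toList σ              ≡⟨ Pointwise-≡⇒≡ (↗↭↗⇒≋ totalOrder (Linked.map inj₁ ascending)
                                                               (sort-↗ (List.allFin n)) σ↭sorted) ⟩
        sorted                ≡⟨ toList-sortedListing ⟨
        toList sortedListing  ∎))
      where
      open ≡-Reasoning
      σ↭sorted = ↭⇒↭ₛ (enumeration-↭ (to listing⇔enumeration σ∈) sorted-enumeration)

    count-ascending-listings≡1 : count ascends (listings n) ≡ 1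
    count-ascending-listings≡1 = count-unique listings-unique sortedListing∈listings
      (from (ascends⇔ sortedListing) (subst (Linked _≺_) (sym toList-sortedListing) sorted-ascending))
      (λ {σ} σ∈ ascending → ascending-listing-unique σ∈ (to (ascends⇔ σ) ascending))
      where
      sortedListing∈listings : sortedListing ∈ listings n
      sortedListing∈listings =
        from listing⇔enumeration (subst IsEnumeration (sym toList-sortedListing) sorted-enumeration)

  count-ascending-listings : count ascends (listings n) ≡ indicator (isProper (incEdge P) f)
  count-ascending-listings with isProper (incEdge P) f in proper
  ... | true  = ChainColouring.count-ascending-listings≡1
                  (to isProper⇔chainColouring (subst T (sym proper) _))
  ... | false = count-none λ {σ} σ∈ ascending → subst T proper (from isProper⇔chainColouring
                  (ascending-enumeration⇒chainColouring (to (ascends⇔ σ) ascending)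
                    (IsEnumeration.complete (to listing⇔enumeration σ∈))))

module _ {n : ℕ} (P : FinPoset n) {m : ℕ} (α : Vec ℕ m) where
  open ColourOrder P using (ascends)

  coeffF-∁XDes≡count-ascending : {σ : Vec (Fin n) n} → σ ∈ listings n →
    coeffF {n} (∁ (XDes (D P) σ)) m α ≡ count (λ f → ascends f σ ∧ hasContent α f) (colourings n m)
  coeffF-∁XDes≡count-ascending {σ} σ∈ = begin
    coeffF {n} (∁ (XDes (D P) σ)) m α
      ≡⟨ count-enumeration-↔ _ (allVecs-enumeration (allFin-enumeration m) n) precompose-↔ ⟩
    count (λ f → compatible (precompose f) (∁ (XDes (D P) σ)) ∧ hasContent α (precompose f)) (colourings n m)
      ≡⟨ count-cong {xs = colourings n m}
           (λ {f} _ → cong₂ _∧_ (ColourOrder.compatible-∁XDes P f σ) (hasContent-precompose α f)) ⟩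
    count (λ f → ascends f σ ∧ hasContent α f) (colourings n m) ∎
    where
    open ≡-Reasoning
    open Precompose σ (to listing⇔enumeration σ∈)

  count-ascending-listings∧hasContent : (f : Vec (Fin m) n) →
    count (λ σ → ascends f σ ∧ hasContent α f) (listings n) ≡ indicator (isProper (incEdge P) f ∧ hasContent α f)
  count-ascending-listings∧hasContent f with hasContent α f
  ... | true  = trans (count-cong {xs = listings n} λ _ → ∧-identityʳ _)
                  (trans (ColourOrder.count-ascending-listings P f) (cong indicator (sym (∧-identityʳ _))))
  ... | false = trans (count-none {xs = listings n} λ {σ} _ → subst T (∧-zeroʳ (ascends f σ)))
                  (cong indicator (sym (∧-zeroʳ _)))

mainTheorem2 : (n : ℕ) (P : FinPoset n) (m : ℕ) (α : Vec ℕ m) →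
    coeffX (incEdge P) m α ≡ coeffFExp (ωF (U P)) m α
mainTheorem2 n P m α = sym (begin
  coeffFExp (ωF (U P)) m α
    ≡⟨ cong sum (trans (map-∘ (listings n)) (map-∘ (map (XDes (D P)) (listings n)))) ⟨
  sum (map (λ σ → coeffF {n} (∁ (XDes (D P) σ)) m α) (listings n))
    ≡⟨ cong sum (map-cong-local (All.tabulate (coeffF-∁XDes≡count-ascending P α))) ⟩
  sum (map (λ σ → count (λ f → ascends f σ ∧ hasContent α f) (colourings n m)) (listings n))
    ≡⟨ sum-count-comm _ (listings n) (colourings n m) ⟩
  sum (map (λ f → count (λ σ → ascends f σ ∧ hasContent α f) (listings n)) (colourings n m))
    ≡⟨ cong sum (map-cong (count-ascending-listings∧hasContent P α) (colourings n m)) ⟩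
  sum (map (λ f → indicator (isProper (incEdge P) f ∧ hasContent α f)) (colourings n m))
    ≡⟨ count-as-sum _ (colourings n m) ⟨
  coeffX (incEdge P) m α ∎)
  where
  open ≡-Reasoning
  open ColourOrder P using (ascends)
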